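{- Let $1\le m,n\le\omega$. Then the term algebras $\mathcal{F}_m$ and $\mathcal{F}_n$ (as $\Sigma$-structures) are isomorphic if and only if they are elementarily equivalent.
   Context: $\Sigma=\{f_0,\dots,f_k\}$ is a finite purely functional signature, $f_i$ of arity $n_i$, with at least one $f_i$ of arity $\ge2$. For a cardinal $\kappa\ge1$, the term algebra $\mathcal{F}_\kappa$ of rank $\kappa$ is the set of all ground terms built from $\kappa$ distinct constant symbols $c_i$ ($i<\kappa$) using the function symbols of $\Sigma$, with $f_i$ interpreted by $f_i(t_1,\dots,t_{n_i}):=$ the term $f_i(t_1,\dots,t_{n_i})$; it is regarded as a structure in the signature $\Sigma$ only (the constants are not part of the language). Equivalently, $\mathcal{F}_\kappa$ is the absolutely free $\Sigma$-algebra on $\kappa$ generators. -}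

module Defs where

open import Data.Nat using (ℕ; zero; suc; _≤_)
open import Data.Fin using (Fin)
open import Data.Vec using (Vec; []; _∷_; map)
open import Data.Product using (_×_; Σ; ∃)
open import Data.Empty using (⊥)
open import Relation.Nullary using (¬_)
open import Relation.Binary.PropositionalEquality using (_≡_)
open import Function.Bundles using (_⤖_; _⇔_; Bijection)

record Signature : Set where
  field
    k       : ℕ
    arity   : Fin (suc k) → ℕ
    hasBinary : ∃ λ i → 2 ≤ arity i
open Signature public

module _ (S : Signature) where

  data Term (G : Set) : Set where
    gen : G → Term G
    app : (i : Fin (suc (k S))) → Vec (Term G) (arity S i) → Term G

  record Structure : Set₁ where
    field
      Carrier : Set
      op      : (i : Fin (suc (k S))) → Vec Carrier (arity S i) → Carrier
  open Structure public

  record _≅_ (A B : Structure) : Set where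
    field
      bij : Carrier A ⤖ Carrier B
      hom : ∀ i (xs : Vec (Carrier A) (arity S i)) →
            Bijection.to bij (op A i xs) ≡ op B i (map (Bijection.to bij) xs)

  -- Ranks 1 ≤ κ ≤ ω : either a finite κ = suc n, or ω.
  data Rank : Set where
    fin   : (n : ℕ) → Rank
    omega : Rank

  Gens : Rank → Set
  Gens (fin n) = Fin (suc n)
  Gens omega   = ℕ

  𝓕 : Rank → Structure
  𝓕 κ = record { Carrier = Term (Gens κ) ; op = app }

  data Formula (n : ℕ) : Set where
    _≐_  : Term (Fin n) → Term (Fin n) → Formula n
    ⊥'   : Formula n
    _⇒_  : Formula n → Formula n → Formula n
    _∧'_ : Formula n → Formula n → Formula n
    ∀'   : Formula (suc n) → Formula n

  ¬' : ∀ {n} → Formula n → Formula n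
  ¬' φ = φ ⇒ ⊥'

  ∃' : ∀ {n} → Formula (suc n) → Formula n
  ∃' φ = ¬' (∀' (¬' φ))

  _∨'_ : ∀ {n} → Formula n → Formula n → Formula n
  φ ∨' ψ = ¬' (¬' φ ∧' ¬' ψ)

  Sentence : Set
  Sentence = Formula 0

  module _ (M : Structure) where
    Env : ℕ → Set
    Env n = Fin n → Carrier M

    extend : ∀ {n} → Carrier M → Env n → Env (suc n)
    extend x ρ Fin.zero    = x
    extend x ρ (Fin.suc i) = ρ i

    mutual
      eval : ∀ {n} → Env n → Term (Fin n) → Carrier M
      eval ρ (gen x)    = ρ x
      eval ρ (app i ts) = op M i (evalVec ρ ts)

      evalVec : ∀ {n m} → Env n → Vec (Term (Fin n)) m → Vec (Carrier M) m
      evalVec ρ []       = []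
      evalVec ρ (t ∷ ts) = eval ρ t ∷ evalVec ρ ts

    -- Satisfaction (classical, via the negative fragment: atomic equality
    -- is read double-negated so every clause is ¬¬-stable).
    Sat : ∀ {n} → Formula n → Env n → Set
    Sat (s ≐ t)  ρ = ¬ ¬ (eval ρ s ≡ eval ρ t)
    Sat ⊥'       ρ = ⊥
    Sat (φ ⇒ ψ)  ρ = Sat φ ρ → Sat ψ ρ
    Sat (φ ∧' ψ) ρ = Sat φ ρ × Sat ψ ρ
    Sat (∀' φ)   ρ = (x : Carrier M) → Sat φ (extend x ρ)

    emptyEnv : Env 0
    emptyEnv ()

    _⊨_ : Sentence → Set
    _⊨_ φ = Sat φ emptyEnv

  _≡ₑ_ : Structure → Structure → Set
  A ≡ₑ B = (φ : Sentence) → (A ⊨ φ) ⇔ (B ⊨ φ)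

{-# OPTIONS --safe #-}
module Submission where

-- An isomorphism preserves satisfaction. Conversely, call an element indecomposable if it
-- is not a value of any operation: in 𝓕_κ these are exactly the generators, and "there are
-- j distinct indecomposable elements" is a first-order sentence. It holds in 𝓕_κ iff
-- Fin j embeds into the generators, i.e. iff j ≤ κ, so elementarily equivalent term
-- algebras have the same rank.

open import Defs
open import Data.Empty using (⊥-elim)
open import Data.Fin using (Fin; zero; suc; _↑ˡ_; _↑ʳ_; _≟_)
open import Data.Fin.Properties using (injective⇒≤; toℕ-injective)
open import Data.Nat using (ℕ; zero; suc; _+_; _≤_; _≤?_; s≤s⁻¹)
open import Data.Nat.Properties using (≤-antisym; 1+n≰n)
open import Data.Product using (_×_; _,_; proj₁; proj₂; ∃)
open import Data.Product.Function.NonDependent.Propositional using (_×-⇔_)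
open import Data.Vec using (Vec; []; _∷_; map; tabulate; lookup)
open import Data.Vec.Properties using (map-id; tabulate∘lookup; tabulate-cong)
open import Function using (_∘_; id)
open import Function.Bundles using (_⇔_; mk⇔; _↣_; mk↣; Bijection; Equivalence; Injection)
open import Function.Construct.Composition using (_⇔-∘_)
open import Function.Construct.Identity using (⇔-id; ⤖-id; ↣-id)
open import Function.Construct.Symmetry using (⇔-sym)
open import Function.Definitions using (Injective)
open import Function.Related.TypeIsomorphisms using (→-cong-⇔; ¬-cong-⇔)
open import Relation.Nullary using (¬_; Dec; yes; no)
open import Relation.Nullary.Decidable using (decidable-stable)
open import Relation.Nullary.Negation using (¬¬-map; negated-stable; ∀¬⟶¬∃; ¬∃⟶∀¬)
open import Relation.Binary.PropositionalEquality
  using (_≡_; _≢_; refl; sym; trans; cong; cong₂; subst)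

open Equivalence using (to; from)

private
  variable
    j m n r : ℕ

subst-⇔ : ∀ {A : Set} (P : A → Set) {x y : A} → x ≡ y → P x ⇔ P y
subst-⇔ P refl = ⇔-id _

≡-cong-⇔ : ∀ {A : Set} {a b c d : A} → a ≡ c → b ≡ d → (a ≡ b) ⇔ (c ≡ d)
≡-cong-⇔ refl refl = ⇔-id _

∀-cong-⇔ : ∀ {A : Set} {P Q : A → Set} → (∀ x → P x ⇔ Q x) → (∀ x → P x) ⇔ (∀ x → Q x)
∀-cong-⇔ P⇔Q = mk⇔ (λ ∀P x → to (P⇔Q x) (∀P x)) (λ ∀Q x → from (P⇔Q x) (∀Q x))

∃-cong-⇔ : ∀ {A : Set} {P Q : A → Set} → (∀ x → P x ⇔ Q x) → ∃ P ⇔ ∃ Q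
∃-cong-⇔ P⇔Q = mk⇔ (λ (x , Px) → x , to (P⇔Q x) Px) (λ (x , Qx) → x , from (P⇔Q x) Qx)

module _ {S : Signature} where

  ≅-refl : (A : Structure S) → _≅_ S A A
  ≅-refl A = record
    { bij = ⤖-id (Carrier A)
    ; hom = λ i xs → cong (op A i) (sym (map-id xs))
    }

  module _ {A B : Structure S} (A≅B : _≅_ S A B) where
    open _≅_ A≅B
    open Bijection bij using (injective; strictlySurjective) renaming (to to h)

    _∼_ : Env S A n → Env S B n → Set
    ρ ∼ σ = ∀ v → h (ρ v) ≡ σ v

    mutual
      eval-≅ : {ρ : Env S A n} {σ : Env S B n} → ρ ∼ σ →
               (t : Term S (Fin n)) → h (eval S A ρ t) ≡ eval S B σ t
      eval-≅ ρ∼σ (gen v)    = ρ∼σ v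
      eval-≅ ρ∼σ (app i ts) = trans (hom i _) (cong (op B i) (evalVec-≅ ρ∼σ ts))

      evalVec-≅ : {ρ : Env S A n} {σ : Env S B n} → ρ ∼ σ →
                  (ts : Vec (Term S (Fin n)) m) → map h (evalVec S A ρ ts) ≡ evalVec S B σ ts
      evalVec-≅ ρ∼σ []       = refl
      evalVec-≅ ρ∼σ (t ∷ ts) = cong₂ _∷_ (eval-≅ ρ∼σ t) (evalVec-≅ ρ∼σ ts)

    extend-∼ : ∀ {x y} {ρ : Env S A n} {σ : Env S B n} →
               h x ≡ y → ρ ∼ σ → extend S A x ρ ∼ extend S B y σ
    extend-∼ hx≡y ρ∼σ zero    = hx≡y
    extend-∼ hx≡y ρ∼σ (suc v) = ρ∼σ v

    Sat-≅ : (φ : Formula S n) {ρ : Env S A n} {σ : Env S B n} →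
            ρ ∼ σ → Sat S A φ ρ ⇔ Sat S B φ σ
    Sat-≅ (s ≐ t) ρ∼σ =
      ¬-cong-⇔ (¬-cong-⇔ (≡-cong-⇔ (eval-≅ ρ∼σ s) (eval-≅ ρ∼σ t) ⇔-∘ mk⇔ (cong h) injective))
    Sat-≅ ⊥'       ρ∼σ = ⇔-id _
    Sat-≅ (φ ⇒ ψ)  ρ∼σ = →-cong-⇔ (Sat-≅ φ ρ∼σ) (Sat-≅ ψ ρ∼σ)
    Sat-≅ (φ ∧' ψ) ρ∼σ = Sat-≅ φ ρ∼σ ×-⇔ Sat-≅ ψ ρ∼σ
    Sat-≅ (∀' φ)   ρ∼σ = mk⇔
      (λ ∀x y → let x , hx≡y = strictlySurjective y in
                to (Sat-≅ φ (extend-∼ hx≡y ρ∼σ)) (∀x x))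
      (λ ∀y x → from (Sat-≅ φ (extend-∼ refl ρ∼σ)) (∀y (h x)))

  ≅⇒≡ₑ : {A B : Structure S} → _≅_ S A B → _≡ₑ_ S A B
  ≅⇒≡ₑ A≅B φ = Sat-≅ A≅B φ (λ ())

  ⊤' : Formula S n
  ⊤' = ⊥' ⇒ ⊥'

  ⋀ : ∀ m → (Fin m → Formula S n) → Formula S n
  ⋀ zero    φ = ⊤'
  ⋀ (suc m) φ = φ zero ∧' ⋀ m (φ ∘ suc)

  ∀ⁿ : ∀ r → Formula S (r + n) → Formula S n
  ∀ⁿ zero    φ = φ
  ∀ⁿ (suc r) φ = ∀ⁿ r (∀' φ)

  ∃ⁿ : ∀ r → Formula S (r + n) → Formula S n
  ∃ⁿ r φ = ¬' S (∀ⁿ r (¬' S φ))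

  module _ (M : Structure S) where

    extendⁿ : (Fin r → Carrier M) → Env S M n → Env S M (r + n)
    extendⁿ {zero}  xs ρ = ρ
    extendⁿ {suc r} xs ρ = extend S M (xs zero) (extendⁿ (xs ∘ suc) ρ)

    extendⁿ-↑ˡ : (xs : Fin r → Carrier M) (ρ : Env S M n) (l : Fin r) →
                 extendⁿ xs ρ (l ↑ˡ n) ≡ xs l
    extendⁿ-↑ˡ xs ρ zero    = refl
    extendⁿ-↑ˡ xs ρ (suc l) = extendⁿ-↑ˡ (xs ∘ suc) ρ l

    extendⁿ-↑ʳ : (xs : Fin r → Carrier M) (ρ : Env S M n) (v : Fin n) →
                 extendⁿ xs ρ (r ↑ʳ v) ≡ ρ v
    extendⁿ-↑ʳ {zero}  xs ρ v = refl
    extendⁿ-↑ʳ {suc r} xs ρ v = extendⁿ-↑ʳ (xs ∘ suc) ρ v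

    Sat-⋀ : (φ : Fin m → Formula S n) (ρ : Env S M n) →
            Sat S M (⋀ m φ) ρ ⇔ (∀ p → Sat S M (φ p) ρ)
    Sat-⋀ {zero}  φ ρ = mk⇔ (λ _ ()) (λ _ → id)
    Sat-⋀ {suc m} φ ρ = mk⇔
      (λ (φ₀ , φ₊) → λ { zero → φ₀ ; (suc p) → to (Sat-⋀ (φ ∘ suc) ρ) φ₊ p })
      (λ ∀φ → ∀φ zero , from (Sat-⋀ (φ ∘ suc) ρ) (∀φ ∘ suc))

    Sat-∀ⁿ : ∀ r (φ : Formula S (r + n)) (ρ : Env S M n) →
             Sat S M (∀ⁿ r φ) ρ ⇔ (∀ xs → Sat S M φ (extendⁿ xs ρ))
    Sat-∀ⁿ zero    φ ρ = mk⇔ (λ φρ _ → φρ) (λ ∀φ → ∀φ (λ ()))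
    Sat-∀ⁿ (suc r) φ ρ = mk⇔
      (λ ∀φ xs → to (Sat-∀ⁿ r (∀' φ) ρ) ∀φ (xs ∘ suc) (xs zero))
      -- extend S M x xs has head x and tail xs by definition, so no transport
      -- between pointwise equal environments is needed.
      (λ ∀φ → from (Sat-∀ⁿ r (∀' φ) ρ) (λ xs x → ∀φ (extend S M x xs)))

    Sat-∃ⁿ : ∀ r (φ : Formula S (r + n)) (ρ : Env S M n) →
             Sat S M (∃ⁿ r φ) ρ ⇔ (¬ ¬ ∃ λ xs → Sat S M φ (extendⁿ xs ρ))
    Sat-∃ⁿ r φ ρ = ¬-cong-⇔ (mk⇔ ∀¬⟶¬∃ ¬∃⟶∀¬ ⇔-∘ Sat-∀ⁿ r (¬' S φ) ρ)

  Indecomposable : (M : Structure S) → Carrier M → Set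
  Indecomposable M x = ∀ i (xs : Vec (Carrier M) (arity S i)) → x ≢ op M i xs

  DistinctIndecomposables : Structure S → ℕ → Set
  DistinctIndecomposables M j =
    ∃ λ (xs : Fin j → Carrier M) → Injective _≡_ _≡_ xs × (∀ p → Indecomposable M (xs p))

  notInImage : ∀ i → Fin n → Formula S (arity S i + n)
  notInImage {n} i v = ¬' S (gen (arity S i ↑ʳ v) ≐ app i (tabulate λ l → gen (l ↑ˡ n)))

  indecomposable : Fin n → Formula S n
  indecomposable v = ⋀ _ λ i → ∀ⁿ (arity S i) (notInImage i v)

  apart : (p q : Fin r) → Dec (p ≡ q) → Formula S (r + n)
  apart         p q (yes _) = ⊤'
  apart {n = n} p q (no _)  = ¬' S (gen (p ↑ˡ n) ≐ gen (q ↑ˡ n))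

  distinctIndecomposables : ∀ r → Formula S (r + n)
  distinctIndecomposables {n} r =
    (⋀ r λ p → ⋀ r λ q → apart p q (p ≟ q)) ∧' ⋀ r (λ p → indecomposable (p ↑ˡ n))

  atLeastIndecomposables : ℕ → Sentence S
  atLeastIndecomposables j = ∃ⁿ j (distinctIndecomposables j)

  module _ (M : Structure S) where

    evalVec-tabulate : (σ : Env S M n) (f : Fin m → Term S (Fin n)) →
                       evalVec S M σ (tabulate f) ≡ tabulate (eval S M σ ∘ f)
    evalVec-tabulate {m = zero}  σ f = refl
    evalVec-tabulate {m = suc m} σ f = cong (eval S M σ (f zero) ∷_) (evalVec-tabulate σ (f ∘ suc))

    Sat-notInImage : ∀ i (xs : Fin (arity S i) → Carrier M) (ρ : Env S M n) v →
                     Sat S M (notInImage i v) (extendⁿ M xs ρ) ⇔ (ρ v ≢ op M i (tabulate xs))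
    Sat-notInImage {n} i xs ρ v = mk⇔
      (λ ¬¬¬atom → negated-stable ¬¬¬atom ∘ from atom⇔)
      (λ ¬eq ¬¬atom → ¬¬atom (¬eq ∘ to atom⇔))
      where
        atom⇔ : (extendⁿ M xs ρ (arity S i ↑ʳ v) ≡
                 op M i (evalVec S M (extendⁿ M xs ρ) (tabulate λ l → gen (l ↑ˡ n)))) ⇔
                (ρ v ≡ op M i (tabulate xs))
        atom⇔ = ≡-cong-⇔ (extendⁿ-↑ʳ M xs ρ v)
                    (cong (op M i) (trans (evalVec-tabulate _ _)
                                          (tabulate-cong (extendⁿ-↑ˡ M xs ρ))))

    Sat-indecomposable : (v : Fin n) (ρ : Env S M n) →
                         Sat S M (indecomposable v) ρ ⇔ Indecomposable M (ρ v)
    Sat-indecomposable v ρ =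
      vectors ⇔-∘ (∀-cong-⇔ (λ i → ∀-cong-⇔ (λ xs → Sat-notInImage i xs ρ v)
                                   ⇔-∘ Sat-∀ⁿ M _ (notInImage i v) ρ)
                   ⇔-∘ Sat-⋀ M _ ρ)
      where
        vectors : (∀ i (xs : Fin (arity S i) → Carrier M) → ρ v ≢ op M i (tabulate xs)) ⇔
                  Indecomposable M (ρ v)
        vectors = mk⇔
          (λ ∀xs i ys → subst (λ zs → ρ v ≢ op M i zs) (tabulate∘lookup ys) (∀xs i (lookup ys)))
          (λ indec i xs → indec i (tabulate xs))

    Sat-apart : (xs : Fin r → Carrier M) (ρ : Env S M n) (p q : Fin r) (p≟q : Dec (p ≡ q)) →
                Sat S M (apart p q p≟q) (extendⁿ M xs ρ) ⇔ (xs p ≡ xs q → p ≡ q)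
    Sat-apart         xs ρ p q (yes p≡q) = mk⇔ (λ _ _ → p≡q) (λ _ → id)
    Sat-apart {n = n} xs ρ p q (no p≢q)  = mk⇔
      (λ ¬¬¬eq eq → ⊥-elim (¬¬¬eq (λ ¬eq → ¬eq (from eq⇔ eq))))
      (λ inj ¬¬eq → ¬¬eq (p≢q ∘ inj ∘ to eq⇔))
      where
        eq⇔ : (extendⁿ M xs ρ (p ↑ˡ n) ≡ extendⁿ M xs ρ (q ↑ˡ n)) ⇔ (xs p ≡ xs q)
        eq⇔ = ≡-cong-⇔ (extendⁿ-↑ˡ M xs ρ p) (extendⁿ-↑ˡ M xs ρ q)

    Sat-distinctIndecomposables : (xs : Fin r → Carrier M) (ρ : Env S M n) →
      Sat S M (distinctIndecomposables r) (extendⁿ M xs ρ) ⇔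
      (Injective _≡_ _≡_ xs × ∀ p → Indecomposable M (xs p))
    Sat-distinctIndecomposables {r} {n} xs ρ = distinct ×-⇔ indecomposables
      where
        ρ′ = extendⁿ M xs ρ

        distinct : Sat S M (⋀ r λ p → ⋀ r λ q → apart p q (p ≟ q)) ρ′ ⇔ Injective _≡_ _≡_ xs
        distinct = mk⇔ (λ inj {p} {q} → inj p q) (λ inj p q → inj)
          ⇔-∘ (∀-cong-⇔ (λ p → ∀-cong-⇔ (λ q → Sat-apart xs ρ p q (p ≟ q)) ⇔-∘ Sat-⋀ M _ ρ′)
               ⇔-∘ Sat-⋀ M _ ρ′)

        indecomposables : Sat S M (⋀ r λ p → indecomposable (p ↑ˡ n)) ρ′ ⇔
                          (∀ p → Indecomposable M (xs p))
        indecomposables = ∀-cong-⇔ (λ p →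
          subst-⇔ (Indecomposable M) (extendⁿ-↑ˡ M xs ρ p) ⇔-∘ Sat-indecomposable (p ↑ˡ n) ρ′)
          ⇔-∘ Sat-⋀ M _ ρ′

    ⊨atLeastIndecomposables : ∀ j →
      _⊨_ S M (atLeastIndecomposables j) ⇔ (¬ ¬ DistinctIndecomposables M j)
    ⊨atLeastIndecomposables j =
      ¬-cong-⇔ (¬-cong-⇔ (∃-cong-⇔ (λ xs → Sat-distinctIndecomposables xs _))) ⇔-∘ Sat-∃ⁿ M j _ _

  gen-injective : ∀ {G : Set} {x y : G} → gen {S} x ≡ gen y → x ≡ y
  gen-injective refl = refl

  module _ (κ : Rank S) where

    gen-indecomposable : (c : Gens S κ) → Indecomposable (𝓕 S κ) (gen c)
    gen-indecomposable c i xs ()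

    indecomposable⇒gen : (t : Term S (Gens S κ)) → Indecomposable (𝓕 S κ) t → ∃ λ c → t ≡ gen c
    indecomposable⇒gen (gen c)    _     = c , refl
    indecomposable⇒gen (app i ts) indec = ⊥-elim (indec i ts refl)

    distinctIndecomposables⇔↣ : DistinctIndecomposables (𝓕 S κ) j ⇔ (Fin j ↣ Gens S κ)
    distinctIndecomposables⇔↣ = mk⇔
      (λ (xs , xs-injective , xs-indec) →
         let c       = λ p → proj₁ (indecomposable⇒gen (xs p) (xs-indec p))
             xs≡gen∘c = λ p → proj₂ (indecomposable⇒gen (xs p) (xs-indec p))
         in mk↣ {to = c} λ {p} {q} cp≡cq →
              xs-injective (trans (xs≡gen∘c p) (trans (cong gen cp≡cq) (sym (xs≡gen∘c q)))))
      (λ f → gen ∘ Injection.to f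
           , (λ {_} {_} → Injection.injective f ∘ gen-injective)
           , gen-indecomposable ∘ Injection.to f)

    𝓕⊨atLeastIndecomposables : ∀ j →
      _⊨_ S (𝓕 S κ) (atLeastIndecomposables j) ⇔ (¬ ¬ (Fin j ↣ Gens S κ))
    𝓕⊨atLeastIndecomposables j =
      ¬-cong-⇔ (¬-cong-⇔ distinctIndecomposables⇔↣) ⇔-∘ ⊨atLeastIndecomposables (𝓕 S κ) j

  ≡ₑ-sym : {A B : Structure S} → _≡ₑ_ S A B → _≡ₑ_ S B A
  ≡ₑ-sym A≡ₑB φ = ⇔-sym (A≡ₑB φ)

  ↣Gens⇒⊨atLeastIndecomposables : (κ : Rank S) → Fin j ↣ Gens S κ →
                                  _⊨_ S (𝓕 S κ) (atLeastIndecomposables j)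
  ↣Gens⇒⊨atLeastIndecomposables κ f = from (𝓕⊨atLeastIndecomposables κ _) (λ ¬f → ¬f f)

  𝓕-fin⊨atLeastIndecomposables⇒≤ : ∀ a → _⊨_ S (𝓕 S (fin a)) (atLeastIndecomposables j) → j ≤ suc a
  𝓕-fin⊨atLeastIndecomposables⇒≤ {j} a ⊨atLeast = decidable-stable (j ≤? suc a)
    (¬¬-map (λ f → injective⇒≤ (Injection.injective f))
            (to (𝓕⊨atLeastIndecomposables (fin a) j) ⊨atLeast))

  ≡ₑ𝓕-fin⇒≤ : ∀ {κ a} → _≡ₑ_ S (𝓕 S κ) (𝓕 S (fin a)) → Fin j ↣ Gens S κ → j ≤ suc a
  ≡ₑ𝓕-fin⇒≤ {j} {κ} {a} κ≡ₑa f = 𝓕-fin⊨atLeastIndecomposables⇒≤ a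
    (to (κ≡ₑa (atLeastIndecomposables j)) (↣Gens⇒⊨atLeastIndecomposables κ f))

  toℕ-↣ : Fin n ↣ ℕ
  toℕ-↣ = mk↣ toℕ-injective

  ≡ₑ⇒≡ : {κ κ′ : Rank S} → _≡ₑ_ S (𝓕 S κ) (𝓕 S κ′) → κ ≡ κ′
  ≡ₑ⇒≡ {fin a} {fin b} a≡ₑb =
    cong fin (≤-antisym (s≤s⁻¹ (≡ₑ𝓕-fin⇒≤ a≡ₑb (↣-id _)))
                        (s≤s⁻¹ (≡ₑ𝓕-fin⇒≤ (≡ₑ-sym a≡ₑb) (↣-id _))))
  ≡ₑ⇒≡ {fin a} {omega} a≡ₑω = ⊥-elim (1+n≰n (≡ₑ𝓕-fin⇒≤ (≡ₑ-sym a≡ₑω) toℕ-↣))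
  ≡ₑ⇒≡ {omega} {fin b} ω≡ₑb = ⊥-elim (1+n≰n (≡ₑ𝓕-fin⇒≤ ω≡ₑb toℕ-↣))
  ≡ₑ⇒≡ {omega} {omega} _    = refl

  ≡⇒≅ : {κ κ′ : Rank S} → κ ≡ κ′ → _≅_ S (𝓕 S κ) (𝓕 S κ′)
  ≡⇒≅ {κ} refl = ≅-refl (𝓕 S κ)

mainTheorem3 : (S : Signature) (m n : Rank S) →
    _≅_ S (𝓕 S m) (𝓕 S n) ⇔ _≡ₑ_ S (𝓕 S m) (𝓕 S n)
mainTheorem3 S m n = mk⇔ ≅⇒≡ₑ (≡⇒≅ ∘ ≡ₑ⇒≡)
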